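{- If $(p,R)$ and $(p,R')$ are isolating mesh patterns with $\mathrm{enc}(p,R)=\mathrm{enc}(p,R')$, then $(p,R)\asymp(p,R')$.
   Context: A mesh pattern is a pair $(p,R)$ where $p\in\mathfrak{S}_k$ and $R\subseteq\{0,\dots,k\}^2$, where $(a,b)\in R$ denotes the unit square $[a,a+1]\times[b,b+1]$ in $[0,k+1]^2$; $G(p)=\{(i,p(i)):i\in[1,k]\}$. A square is pointless if none of its four corners lies in $G(p)$. The mesh pattern $(p,R)$ is isolating if whenever $(i,j)\in R$ is not a pointless square, then $R$ contains no square of the form $(i\pm1,y)$ or $(x,j\pm1)$ (for any $x,y$). A permutation $w\in\mathfrak{S}_n$ contains $(p,R)$ if there are indices $1\le i_1<\dots<i_k\le n$ with $w(i_1)\cdots w(i_k)$ order isomorphic to $p$ such that, setting $i_0=0$, $i_{k+1}=n+1$, $v_0=0$, $v_{k+1}=n+1$ and $v_b=w(i_{p^{ -1}(b)})$ for $b\in[1,k]$, for every $(a,b)\in R$ the open rectangle $(i_a,i_{a+1})\times(v_b,v_{b+1})$ contains no point $(x,w(x))$. Mesh patterns $\pi,\sigma$ are coincident, $\pi\asymp\sigma$, if they are avoided by exactly the same permutations (of all sizes). Enclosed diagonals: for integers $a,b\ge0$, $c\ge1$, $D=\{(a+i,b+i): i\in[0,c]\}\subseteq R$ is an enclosed NE-diagonal if $\{(a+i,b+i): i\in[0,c+1]\}\cap G(p)=\{(a+i,b+i): i\in[1,c]\}$ (lattice points), and $D=\{(a+i,b-i): i\in[0,c]\}\subseteq R$ is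 an enclosed SE-diagonal if $\{(a+i,b+1-i): i\in[0,c+1]\}\cap G(p)=\{(a+i,b+1-i): i\in[1,c]\}$. Also, a single pointless square $\{(a,b)\}\subseteq R$ is an enclosed diagonal of length $1$. $\mathrm{enc}(p,R)$ is the set of all enclosed diagonals of $(p,R)$. -}

module Defs where

open import Data.Nat using (ℕ; zero; suc; _+_; _∸_; _≤_; _<_; _<?_)
open import Data.Fin using (Fin; toℕ; fromℕ<)
import Data.Fin as F
open import Data.Fin.Permutation using (Permutation′; _⟨$⟩ʳ_; _⟨$⟩ˡ_)
open import Data.Bool using (Bool; true)
open import Data.Product using (Σ; Σ-syntax; _×_; _,_)
open import Data.Sum using (_⊎_)
open import Data.Empty using (⊥)
open import Relation.Nullary using (¬_; yes; no)
open import Relation.Binary.PropositionalEquality using (_≡_)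
open import Level using () renaming (zero to 0ℓ)

-- A permutation p ∈ 𝔖_k is a bijection Fin k ↔ Fin k;
-- Fin index i stands for the 1-based position i+1, and value p(i) for
-- the 1-based value (p i)+1.  Lattice points and squares use ℕ
-- coordinates exactly as in the paper.

Mesh : ℕ → Set
Mesh k = Fin (suc k) → Fin (suc k) → Bool

record MeshPattern : Set where
  constructor mp
  field
    size : ℕ
    perm : Permutation′ size
    mesh : Mesh size
open MeshPattern public

InR : ∀ {k} → Mesh k → ℕ → ℕ → Set
InR {k} R a b =
  Σ (a < suc k) λ ha → Σ (b < suc k) λ hb → R (fromℕ< ha) (fromℕ< hb) ≡ true

InG : ∀ {k} → Permutation′ k → ℕ → ℕ → Set
InG {k} p x y = Σ (Fin k) λ i → (x ≡ suc (toℕ i)) × (y ≡ suc (toℕ (p ⟨$⟩ʳ i)))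

Pointless : ∀ {k} → Permutation′ k → ℕ → ℕ → Set
Pointless p a b =
  ¬ InG p a b × ¬ InG p (suc a) b × ¬ InG p a (suc b) × ¬ InG p (suc a) (suc b)

Isolating : MeshPattern → Set
Isolating (mp k p R) =
  ∀ i j → InR R i j → ¬ Pointless p i j →
  ∀ x y → InR R x y →
  ¬ (x ≡ suc i ⊎ suc x ≡ i ⊎ y ≡ suc j ⊎ suc y ≡ j)

SquareSet : Set₁
SquareSet = ℕ → ℕ → Set

_⊆R_ : ∀ {k} → SquareSet → Mesh k → Set
D ⊆R R = ∀ x y → D x y → InR R x y

_≐_ : SquareSet → SquareSet → Set
D ≐ E = ∀ x y → (D x y → E x y) × (E x y → D x y)

NEDiag : ℕ → ℕ → ℕ → SquareSet
NEDiag a b c x y = Σ ℕ λ i → i ≤ c × x ≡ a + i × y ≡ b + i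

-- {(a+i , b-i) : i ∈ [0,c]}   (used only when c ≤ b)
SEDiag : ℕ → ℕ → ℕ → SquareSet
SEDiag a b c x y = Σ ℕ λ i → i ≤ c × x ≡ a + i × y ≡ b ∸ i

Singleton : ℕ → ℕ → SquareSet
Singleton a b x y = x ≡ a × y ≡ b

NEEnclosedPts : ∀ {k} → Permutation′ k → ℕ → ℕ → ℕ → Set
NEEnclosedPts p a b c =
  ∀ i → i ≤ suc c → (InG p (a + i) (b + i) → 1 ≤ i × i ≤ c)
                   × (1 ≤ i × i ≤ c → InG p (a + i) (b + i))

SEEnclosedPts : ∀ {k} → Permutation′ k → ℕ → ℕ → ℕ → Set
SEEnclosedPts p a b c =
  ∀ i → i ≤ suc c → (InG p (a + i) (suc b ∸ i) → 1 ≤ i × i ≤ c)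
                   × (1 ≤ i × i ≤ c → InG p (a + i) (suc b ∸ i))

IsEnclosedDiagonal : MeshPattern → SquareSet → Set
IsEnclosedDiagonal (mp k p R) D =
    (Σ ℕ λ a → Σ ℕ λ b → Σ ℕ λ c →
       1 ≤ c × (D ≐ NEDiag a b c) × (D ⊆R R) × NEEnclosedPts p a b c)
  ⊎ (Σ ℕ λ a → Σ ℕ λ b → Σ ℕ λ c →
       1 ≤ c × c ≤ b × (D ≐ SEDiag a b c) × (D ⊆R R) × SEEnclosedPts p a b c)
  ⊎ (Σ ℕ λ a → Σ ℕ λ b →
       (D ≐ Singleton a b) × (D ⊆R R) × Pointless p a b)

SameEnc : MeshPattern → MeshPattern → Set₁
SameEnc π σ = ∀ (D : SquareSet) →
  (IsEnclosedDiagonal π D → IsEnclosedDiagonal σ D) ×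
  (IsEnclosedDiagonal σ D → IsEnclosedDiagonal π D)

ext : ∀ {k} → ℕ → (Fin k → ℕ) → ℕ → ℕ
ext n f zero = zero
ext {k} n f (suc a) with a <? k
... | yes h = f (fromℕ< h)
... | no _  = suc n

Contains : ∀ {n} → Permutation′ n → MeshPattern → Set
Contains {n} w (mp k p R) =
  Σ (Fin k → Fin n) λ ι →
    (∀ i j → i F.< j → ι i F.< ι j)
  × (∀ i j → (w ⟨$⟩ʳ ι i F.< w ⟨$⟩ʳ ι j → p ⟨$⟩ʳ i F.< p ⟨$⟩ʳ j)
           × (p ⟨$⟩ʳ i F.< p ⟨$⟩ʳ j → w ⟨$⟩ʳ ι i F.< w ⟨$⟩ʳ ι j))
  × (∀ a b → InR R a b → ∀ (x : Fin n) →
       let I = ext n (λ i → suc (toℕ (ι i)))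
           V = ext n (λ b′ → suc (toℕ (w ⟨$⟩ʳ ι (p ⟨$⟩ˡ b′))))
       in ¬ ((I a < suc (toℕ x)) × (suc (toℕ x) < I (suc a))
           × (V b < suc (toℕ (w ⟨$⟩ʳ x))) × (suc (toℕ (w ⟨$⟩ʳ x)) < V (suc b))))

Avoids : ∀ {n} → Permutation′ n → MeshPattern → Set
Avoids w π = ¬ Contains w π

Coincident : MeshPattern → MeshPattern → Set
Coincident π σ = ∀ n (w : Permutation′ n) →
  (Avoids w π → Avoids w σ) × (Avoids w σ → Avoids w π)

module Submission where

-- Squares of R with a point of G(p) at a corner can be ignored: if an
-- occurrence ι of p in w leaves a point Q inside such a shaded square, move
-- the pattern point at that corner onto Q.  The result is again an occurrence
-- of p; the grid lines that move are the boundaries of the square, so only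
-- the strips of the square's neighbouring columns and rows can grow, and in
-- an isolating pattern those contain no shaded square.  Hence the set of
-- points lying in shaded regions strictly shrinks, and by well-founded
-- induction on finite subsets some occurrence leaves all shaded regions
-- empty, provided the pointless shaded squares were empty from the start.
-- Pointless shaded squares are exactly the enclosed diagonals of length one,
-- so they agree for R and R′, and each of the two patterns is contained
-- whenever the other one is.

open import Defs
open import Data.Nat using (ℕ; zero; suc; _≤_; _<_; _<?_; _≟_; z≤n; s≤s)
open import Data.Nat.Properties
open import Data.Fin using (Fin; toℕ; fromℕ<)
import Data.Fin as F
import Data.Fin.Properties as F
open import Data.Fin.Permutation using (Permutation′; _⟨$⟩ʳ_; _⟨$⟩ˡ_; inverseˡ; inverseʳ)
open import Data.Fin.Subset using (Subset; _∈_; _⊂_)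
open import Data.Fin.Subset.Induction using (⊂-wellFounded)
open import Data.Vec using (tabulate)
open import Data.Vec.Properties using (lookup∘tabulate; lookup⇒[]=; []=⇒lookup)
open import Data.Vec.Functional using (updateAt)
open import Data.Vec.Functional.Properties using (updateAt-updates; updateAt-minimal)
open import Data.Bool using (true)
import Data.Bool as Bool
open import Data.Product using (Σ; _×_; _,_; proj₁; proj₂)
open import Data.Sum using (_⊎_; inj₁; inj₂; [_,_])
open import Data.Empty using (⊥-elim)
open import Function using (id; const; _∘′_)
open import Induction.WellFounded using (Acc; acc)
open import Relation.Binary.Definitions using (tri<; tri≈; tri>)
open import Relation.Nullary using (¬_; yes; no; Dec; does)
open import Relation.Nullary.Decidable using (_×-dec_; dec-true)
open import Relation.Binary.PropositionalEquality hiding ([_])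

Update : ∀ {k} {A : Set} → (Fin k → A) → Fin k → A → (Fin k → A) → Set
Update h i₀ q h′ = (∀ i → i ≢ i₀ → h′ i ≡ h i) × h′ i₀ ≡ q

Update-map : ∀ {k} {A B : Set} (φ : A → B) {h h′ : Fin k → A} {i₀ q} → Update h i₀ q h′ →
  Update (λ i → φ (h i)) i₀ (φ q) (λ i → φ (h′ i))
Update-map φ (off , at) = (λ i i≢i₀ → cong φ (off i i≢i₀)) , cong φ at

updateAt-Update : ∀ {k} {A : Set} (h : Fin k → A) i₀ q → Update h i₀ q (updateAt h i₀ (const q))
updateAt-Update h i₀ q = (λ i i≢i₀ → updateAt-minimal i i₀ h i≢i₀) , updateAt-updates i₀ h

-- Grid lines.  A family f of 1-based coordinates indexed by Fin k is
-- extended by ext to the grid lines 0, f 0, …, f (k-1), n+1.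

Monotone : ∀ {k} → (Fin k → ℕ) → Set
Monotone f = ∀ i j → toℕ i ≤ toℕ j → f i ≤ f j

Bounded : ∀ {k} → ℕ → (Fin k → ℕ) → Set
Bounded n f = ∀ i → f i ≤ suc n

strict⇒monotone : ∀ {k} (f : Fin k → ℕ) → (∀ i j → i F.< j → f i < f j) → Monotone f
strict⇒monotone f strict i j i≤j with m≤n⇒m<n∨m≡n i≤j
... | inj₁ i<j = <⇒≤ (strict i j i<j)
... | inj₂ i≡j rewrite F.toℕ-injective i≡j = ≤-refl

InStrip : (ℕ → ℕ) → ℕ → ℕ → Set
InStrip E c z = E c < z × z < E (suc c)

Adjacent : ℕ → ℕ → Set
Adjacent x c = x ≡ c ⊎ x ≡ suc c

ext-inside : ∀ {k} n (f : Fin k → ℕ) a (a<k : a < k) → ext n f (suc a) ≡ f (fromℕ< a<k)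
ext-inside {k} n f a a<k with a <? k
... | yes _ = refl
... | no a≮k = ⊥-elim (a≮k a<k)

ext-index : ∀ {k} n (f : Fin k → ℕ) (i : Fin k) → ext n f (suc (toℕ i)) ≡ f i
ext-index n f i = trans (ext-inside n f (toℕ i) (F.toℕ<n i)) (cong f (F.fromℕ<-toℕ i (F.toℕ<n i)))

ext-outside : ∀ {k} n (f : Fin k → ℕ) a → ¬ a < k → ext n f (suc a) ≡ suc n
ext-outside {k} n f a a≮k with a <? k
... | yes a<k = ⊥-elim (a≮k a<k)
... | no _ = refl

ext-bounded : ∀ {k} n (f : Fin k → ℕ) → Bounded n f → ∀ d → ext n f d ≤ suc n
ext-bounded n f bounded zero = z≤n
ext-bounded {k} n f bounded (suc a) with a <? k
... | yes _ = bounded _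
... | no _ = ≤-refl

ext-update : ∀ {k} n (f f′ : Fin k → ℕ) m y → Update f m y f′ →
  ext n f′ (suc (toℕ m)) ≡ y × (∀ d → d ≢ suc (toℕ m) → ext n f′ d ≡ ext n f d)
ext-update {k} n f f′ m y (off , at) = trans (ext-index n f′ m) at , unmoved
  where
  unmoved : ∀ d → d ≢ suc (toℕ m) → ext n f′ d ≡ ext n f d
  unmoved zero _ = refl
  unmoved (suc a) d≢ with a <? k
  ... | yes a<k = off _ (λ eq → d≢ (cong suc (trans (sym (F.toℕ-fromℕ< a<k)) (cong toℕ eq))))
  ... | no _ = refl

strip-shrinks : ∀ {k} n (f f′ : Fin k → ℕ) m y → Update f m y f′ →
  ∀ c₀ → InStrip (ext n f) c₀ y → Adjacent (suc (toℕ m)) c₀ →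
  ∀ c → c ≢ suc c₀ → suc c ≢ c₀ → ∀ z → InStrip (ext n f′) c z → InStrip (ext n f) c z
strip-shrinks n f f′ m y upd c₀ (lo₀ , hi₀) adj c c≢ sc≢ z (lo , hi) = lower , upper
  where
  E E′ : ℕ → ℕ
  E = ext n f
  E′ = ext n f′
  moved : E′ (suc (toℕ m)) ≡ y
  moved = proj₁ (ext-update n f f′ m y upd)
  unmoved : ∀ d → d ≢ suc (toℕ m) → E′ d ≡ E d
  unmoved = proj₂ (ext-update n f f′ m y upd)

  -- Adjacency and the side conditions pin down which boundary of c₀ moved.
  left-moved : c ≡ suc (toℕ m) → suc (toℕ m) ≡ c₀
  left-moved c≡M = [ id , (λ M≡sc₀ → ⊥-elim (c≢ (trans c≡M M≡sc₀))) ] adj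
  right-moved : suc c ≡ suc (toℕ m) → suc (toℕ m) ≡ suc c₀
  right-moved sc≡M = [ (λ M≡c₀ → ⊥-elim (sc≢ (trans sc≡M M≡c₀))) , id ] adj

  lower : E c < z
  lower with c ≟ suc (toℕ m)
  ... | no c≢M = subst (_< z) (unmoved c c≢M) lo
  ... | yes c≡M = <-trans (subst (λ t → E t < y) (sym (trans c≡M (left-moved c≡M))) lo₀)
                          (subst (_< z) (trans (cong E′ c≡M) moved) lo)

  upper : z < E (suc c)
  upper with suc c ≟ suc (toℕ m)
  ... | no sc≢M = subst (z <_) (unmoved (suc c) sc≢M) hi
  ... | yes sc≡M = <-trans (subst (z <_) (trans (cong E′ sc≡M) moved) hi)
                           (subst (λ t → y < E t) (sym (trans sc≡M (right-moved sc≡M))) hi₀)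

adjacent-bounds : ∀ {m c} → Adjacent (suc m) c → m ≤ c × c ≤ suc m
adjacent-bounds (inj₁ refl) = n≤1+n _ , ≤-refl
adjacent-bounds (inj₂ refl) = ≤-refl , n≤1+n _

module GridLines {k : ℕ} (n : ℕ) (f : Fin k → ℕ) (mono : Monotone f) (bounded : Bounded n f) where

  ext-mono : ∀ c d → c ≤ d → ext n f c ≤ ext n f d
  ext-mono zero d _ = z≤n
  ext-mono (suc a) (suc b) (s≤s a≤b) = by-cases (b <? k)
    where
    by-cases : Dec (b < k) → ext n f (suc a) ≤ ext n f (suc b)
    by-cases (no b≮k) = subst (ext n f (suc a) ≤_) (sym (ext-outside n f b b≮k)) (ext-bounded n f bounded (suc a))
    by-cases (yes b<k) = subst₂ _≤_ (sym (ext-inside n f a a<k)) (sym (ext-inside n f b b<k))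
                          (mono _ _ (subst₂ _≤_ (sym (F.toℕ-fromℕ< a<k)) (sym (F.toℕ-fromℕ< b<k)) a≤b))
      where
      a<k : a < k
      a<k = ≤-<-trans a≤b b<k

  separates : ∀ c y → InStrip (ext n f) c y →
    ∀ j → (suc (toℕ j) ≤ c → f j < y) × (c < suc (toℕ j) → y < f j)
  separates c y (lo , hi) j =
    (λ before → ≤-<-trans (subst (_≤ ext n f c) (ext-index n f j) (ext-mono _ _ before)) lo) ,
    (λ after → <-≤-trans hi (subst (ext n f (suc c) ≤_) (ext-index n f j) (ext-mono _ _ after)))

  line-not-in-strip : ∀ c j → ¬ InStrip (ext n f) c (f j)
  line-not-in-strip c j inStrip with suc (toℕ j) ≤? c
  ... | yes before = <-irrefl refl (proj₁ (separates c (f j) inStrip j) before)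
  ... | no after = <-irrefl refl (proj₂ (separates c (f j) inStrip j) (≰⇒> after))

  separates-around : ∀ c y → InStrip (ext n f) c y → (m : Fin k) → Adjacent (suc (toℕ m)) c →
    ∀ j → (toℕ j < toℕ m → f j < y) × (toℕ m < toℕ j → y < f j)
  separates-around c y inStrip m adj j =
    (λ j<m → proj₁ (separates c y inStrip j) (≤-trans j<m (proj₁ (adjacent-bounds adj)))) ,
    (λ m<j → proj₂ (separates c y inStrip j) (≤-<-trans (proj₂ (adjacent-bounds adj)) (s≤s m<j)))

OrderPreserving : ∀ {k a b} → (Fin k → Fin a) → (Fin k → Fin b) → Set
OrderPreserving g h = ∀ i j → g i F.< g j → h i F.< h j

reflects : ∀ {k a b} (g : Fin k → Fin a) (h : Fin k → Fin b) → (∀ {i j} → g i ≡ g j → i ≡ j) →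
  OrderPreserving g h → ∀ i j → h i F.< h j → g i F.< g j
reflects g h injective preserving i j hi<hj with F.<-cmp (g i) (g j)
... | tri< gi<gj _ _ = gi<gj
... | tri≈ _ gi≡gj _ = ⊥-elim (F.<-irrefl (cong h (injective gi≡gj)) hi<hj)
... | tri> _ _ gj<gi = ⊥-elim (F.<-asym hi<hj (preserving j i gj<gi))

update-preserves : ∀ {k a b} (g : Fin k → Fin a) (h h′ : Fin k → Fin b) i₀ q → Update h i₀ q h′ →
  OrderPreserving g h → (∀ j → g j F.< g i₀ → h j F.< q) → (∀ j → g i₀ F.< g j → q F.< h j) →
  OrderPreserving g h′
update-preserves g h h′ i₀ q (off , at) preserving below above i j gi<gj with i F.≟ i₀ | j F.≟ i₀
... | yes refl | yes refl = ⊥-elim (F.<-irrefl refl gi<gj)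
... | yes refl | no j≢i₀ = subst₂ F._<_ (sym at) (sym (off j j≢i₀)) (above j gi<gj)
... | no i≢i₀ | yes refl = subst₂ F._<_ (sym (off i i≢i₀)) (sym at) (below i gi<gj)
... | no i≢i₀ | no j≢i₀ = subst₂ F._<_ (sym (off i i≢i₀)) (sym (off j j≢i₀)) (preserving i j gi<gj)

-- The subset of Fin n cut out by a decidable predicate; the well-foundedness
-- of strict inclusion on such subsets drives the descent below.
subset : ∀ {n} {P : Fin n → Set} → (∀ x → Dec (P x)) → Subset n
subset d = tabulate (λ x → does (d x))

∈-subset : ∀ {n} {P : Fin n → Set} (d : ∀ x → Dec (P x)) {x} → P x → x ∈ subset d
∈-subset d {x} px = lookup⇒[]= x _ (trans (lookup∘tabulate _ x) (dec-true (d x) px))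

∈-subset⁻ : ∀ {n} {P : Fin n → Set} (d : ∀ x → Dec (P x)) {x} → x ∈ subset d → P x
∈-subset⁻ d {x} x∈ with d x | trans (sym (lookup∘tabulate (λ y → does (d y)) x)) ([]=⇒lookup x∈)
... | yes px | _ = px
... | no _ | ()

-- An embedding ι : Fin k → Fin n places the i-th
-- pattern point at position ι i of w; pos and val are its 1-based
-- coordinates, indexed by pattern position and by pattern value.

module Occurrences {k : ℕ} (p : Permutation′ k) (R : Mesh k) {n : ℕ} (w : Permutation′ n) where

  pos : (Fin k → Fin n) → Fin k → ℕ
  pos ι i = suc (toℕ (ι i))

  val : (Fin k → Fin n) → Fin k → ℕ
  val ι b = suc (toℕ (w ⟨$⟩ʳ ι (p ⟨$⟩ˡ b)))

  val-at : ∀ ι m → val ι (p ⟨$⟩ʳ m) ≡ suc (toℕ (w ⟨$⟩ʳ ι m))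
  val-at ι m = cong (λ i → suc (toℕ (w ⟨$⟩ʳ ι i))) (inverseˡ p)

  Region : (Fin k → Fin n) → ℕ → ℕ → Fin n → Set
  Region ι a b x = InStrip (ext n (pos ι)) a (suc (toℕ x)) × InStrip (ext n (val ι)) b (suc (toℕ (w ⟨$⟩ʳ x)))

  Occurrence : (Fin k → Fin n) → Set
  Occurrence ι = OrderPreserving id ι × OrderPreserving (p ⟨$⟩ʳ_) (λ i → w ⟨$⟩ʳ ι i)

  PointlessClear : (Fin k → Fin n) → Set
  PointlessClear ι = ∀ a b → InR R a b → Pointless p a b → ∀ x → ¬ Region ι a b x

  pos-monotone : ∀ ι → Occurrence ι → Monotone (pos ι)
  pos-monotone ι (increasing , _) = strict⇒monotone (pos ι) (λ i j i<j → s≤s (increasing i j i<j))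

  val-monotone : ∀ ι → Occurrence ι → Monotone (val ι)
  val-monotone ι (_ , ordered) = strict⇒monotone (val ι) λ b b′ b<b′ →
    s≤s (ordered (p ⟨$⟩ˡ b) (p ⟨$⟩ˡ b′) (subst₂ F._<_ (sym (inverseʳ p)) (sym (inverseʳ p)) b<b′))

  pos-bounded : ∀ ι → Bounded n (pos ι)
  pos-bounded ι i = m≤n⇒m≤1+n (F.toℕ<n (ι i))

  val-bounded : ∀ ι → Bounded n (val ι)
  val-bounded ι b = m≤n⇒m≤1+n (F.toℕ<n (w ⟨$⟩ʳ _))

  Neighbouring : ℕ → ℕ → ℕ → ℕ → Set
  Neighbouring a b c d = c ≡ suc a ⊎ suc c ≡ a ⊎ d ≡ suc b ⊎ suc d ≡ b

  module Replace (ι : Fin k → Fin n) (occ : Occurrence ι) (a b : ℕ) (Q : Fin n)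
                 (inRegion : Region ι a b Q) (m : Fin k)
                 (adjX : Adjacent (suc (toℕ m)) a) (adjY : Adjacent (suc (toℕ (p ⟨$⟩ʳ m))) b) where

    ι′ : Fin k → Fin n
    ι′ = updateAt ι m (const Q)

    ι′-update : Update ι m Q ι′
    ι′-update = updateAt-Update ι m Q

    pos-update : Update (pos ι) m (suc (toℕ Q)) (pos ι′)
    pos-update = Update-map (λ x → suc (toℕ x)) ι′-update

    val-update : Update (val ι) (p ⟨$⟩ʳ m) (suc (toℕ (w ⟨$⟩ʳ Q))) (val ι′)
    val-update = (λ b b≢pm → cong (λ x → suc (toℕ (w ⟨$⟩ʳ x)))
                   (proj₁ ι′-update _ (λ eq → b≢pm (trans (sym (inverseʳ p)) (cong (p ⟨$⟩ʳ_) eq)))))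
               , trans (val-at ι′ m) (cong (λ x → suc (toℕ (w ⟨$⟩ʳ x))) (proj₂ ι′-update))

    module X = GridLines n (pos ι) (pos-monotone ι occ) (pos-bounded ι)
    module Y = GridLines n (val ι) (val-monotone ι occ) (val-bounded ι)

    -- Q sits among the other occurrence points exactly where m sat.
    pos-below : ∀ j → j F.< m → ι j F.< Q
    pos-below j j<m = ≤-pred (proj₁ (X.separates-around a _ (proj₁ inRegion) m adjX j) j<m)

    pos-above : ∀ j → m F.< j → Q F.< ι j
    pos-above j m<j = ≤-pred (proj₂ (X.separates-around a _ (proj₁ inRegion) m adjX j) m<j)

    val-below : ∀ j → p ⟨$⟩ʳ j F.< p ⟨$⟩ʳ m → w ⟨$⟩ʳ ι j F.< w ⟨$⟩ʳ Q
    val-below j pj<pm = ≤-pred (subst (_< suc (toℕ (w ⟨$⟩ʳ Q))) (val-at ι j)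
      (proj₁ (Y.separates-around b _ (proj₂ inRegion) (p ⟨$⟩ʳ m) adjY (p ⟨$⟩ʳ j)) pj<pm))

    val-above : ∀ j → p ⟨$⟩ʳ m F.< p ⟨$⟩ʳ j → w ⟨$⟩ʳ Q F.< w ⟨$⟩ʳ ι j
    val-above j pm<pj = ≤-pred (subst (suc (toℕ (w ⟨$⟩ʳ Q)) <_) (val-at ι j)
      (proj₂ (Y.separates-around b _ (proj₂ inRegion) (p ⟨$⟩ʳ m) adjY (p ⟨$⟩ʳ j)) pm<pj))

    w∘ι′-update : Update (λ i → w ⟨$⟩ʳ ι i) m (w ⟨$⟩ʳ Q) (λ i → w ⟨$⟩ʳ ι′ i)
    w∘ι′-update = Update-map (w ⟨$⟩ʳ_) ι′-update

    occ′ : Occurrence ι′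
    occ′ = update-preserves id ι ι′ m Q ι′-update (proj₁ occ) pos-below pos-above
         , update-preserves (p ⟨$⟩ʳ_) (λ i → w ⟨$⟩ʳ ι i) (λ i → w ⟨$⟩ʳ ι′ i) m (w ⟨$⟩ʳ Q)
             w∘ι′-update (proj₂ occ) val-below val-above

    region-shrinks : ∀ c d → ¬ Neighbouring a b c d → ∀ z → Region ι′ c d z → Region ι c d z
    region-shrinks c d far z (inX , inY) =
        strip-shrinks n (pos ι) (pos ι′) m _ pos-update a (proj₁ inRegion) adjX
          c (λ e → far (inj₁ e)) (λ e → far (inj₂ (inj₁ e))) _ inX
      , strip-shrinks n (val ι) (val ι′) (p ⟨$⟩ʳ m) _ val-update b (proj₂ inRegion) adjY
          d (λ e → far (inj₂ (inj₂ (inj₁ e)))) (λ e → far (inj₂ (inj₂ (inj₂ e)))) _ inY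

    -- Q is now a pattern point, so it lies in no region.
    Q-free : ∀ c d → ¬ Region ι′ c d Q
    Q-free c d (inX , _) =
      X′.line-not-in-strip c m (subst (InStrip (ext n (pos ι′)) c) (sym (proj₂ pos-update)) inX)
      where module X′ = GridLines n (pos ι′) (pos-monotone ι′ occ′) (pos-bounded ι′)

  InG? : ∀ x y → Dec (InG p x y)
  InG? x y = F.any? (λ i → (x ≟ suc (toℕ i)) ×-dec (y ≟ suc (toℕ (p ⟨$⟩ʳ i))))

  corner-of : ∀ a b → ¬ Pointless p a b →
    Σ (Fin k) λ m → Adjacent (suc (toℕ m)) a × Adjacent (suc (toℕ (p ⟨$⟩ʳ m))) b
  corner-of a b notPointless with InG? a b | InG? (suc a) b | InG? a (suc b) | InG? (suc a) (suc b)
  ... | yes (m , ex , ey) | _ | _ | _ = m , inj₁ (sym ex) , inj₁ (sym ey)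
  ... | _ | yes (m , ex , ey) | _ | _ = m , inj₂ (sym ex) , inj₁ (sym ey)
  ... | _ | _ | yes (m , ex , ey) | _ = m , inj₁ (sym ex) , inj₂ (sym ey)
  ... | _ | _ | _ | yes (m , ex , ey) = m , inj₂ (sym ex) , inj₂ (sym ey)
  ... | no g₁ | no g₂ | no g₃ | no g₄ = ⊥-elim (notPointless (g₁ , g₂ , g₃ , g₄))

  Bad : (Fin k → Fin n) → Fin n → Set
  Bad ι x = Σ (Fin (suc k)) λ a → Σ (Fin (suc k)) λ b → R a b ≡ true × Region ι (toℕ a) (toℕ b) x

  Bad? : ∀ ι x → Dec (Bad ι x)
  Bad? ι x = F.any? λ a → F.any? λ b → (R a b Bool.≟ true)
    ×-dec (((_ <? _) ×-dec (_ <? _)) ×-dec ((_ <? _) ×-dec (_ <? _)))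

  InR-toℕ : ∀ (a b : Fin (suc k)) → R a b ≡ true → InR R (toℕ a) (toℕ b)
  InR-toℕ a b r = F.toℕ<n a , F.toℕ<n b ,
    subst₂ (λ x y → R x y ≡ true) (sym (F.fromℕ<-toℕ a (F.toℕ<n a))) (sym (F.fromℕ<-toℕ b (F.toℕ<n b))) r

  descend : Isolating (mp k p R) → ∀ ι → Occurrence ι → PointlessClear ι → ∀ Q → Bad ι Q →
    Σ (Fin k → Fin n) λ ι′ → Occurrence ι′ × PointlessClear ι′ × subset (Bad? ι′) ⊂ subset (Bad? ι)
  descend isolating ι occ clear Q bad@(a , b , r , inRegion) = ι′ , occ′ , clear′ , fewerBad
    where
    notPointless : ¬ Pointless p (toℕ a) (toℕ b)
    notPointless pointless = clear _ _ (InR-toℕ a b r) pointless Q inRegion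
    corner : Σ (Fin k) λ m → Adjacent (suc (toℕ m)) (toℕ a) × Adjacent (suc (toℕ (p ⟨$⟩ʳ m))) (toℕ b)
    corner = corner-of _ _ notPointless
    open Replace ι occ (toℕ a) (toℕ b) Q inRegion (proj₁ corner) (proj₁ (proj₂ corner)) (proj₂ (proj₂ corner))
    far : ∀ c d → InR R c d → ¬ Neighbouring (toℕ a) (toℕ b) c d
    far = isolating _ _ (InR-toℕ a b r) notPointless
    clear′ : PointlessClear ι′
    clear′ c d inR pointless x = clear c d inR pointless x ∘′ region-shrinks c d (far c d inR) x
    fewerBad : subset (Bad? ι′) ⊂ subset (Bad? ι)
    fewerBad = (λ x∈ → let (c , d , r′ , reg) = ∈-subset⁻ (Bad? ι′) x∈ in
                 ∈-subset (Bad? ι) (c , d , r′ , region-shrinks _ _ (far _ _ (InR-toℕ c d r′)) _ reg))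
             , Q , ∈-subset (Bad? ι) bad
             , (λ Q∈ → let (c , d , _ , reg) = ∈-subset⁻ (Bad? ι′) Q∈ in Q-free _ _ reg)

  contains : ∀ ι → Occurrence ι → (∀ x → ¬ Bad ι x) → Contains w (mp k p R)
  contains ι (increasing , ordered) noBad =
    ι , increasing
      , (λ i j → reflects (p ⟨$⟩ʳ_) (λ i → w ⟨$⟩ʳ ι i) p-injective ordered i j , ordered i j)
      , λ { a b (a< , b< , r) x (lo , hi , vlo , vhi) → noBad x (fromℕ< a< , fromℕ< b< , r ,
              subst₂ (λ s t → Region ι s t x) (sym (F.toℕ-fromℕ< a<)) (sym (F.toℕ-fromℕ< b<))
                ((lo , hi) , (vlo , vhi))) }
    where
    p-injective : ∀ {i j} → p ⟨$⟩ʳ i ≡ p ⟨$⟩ʳ j → i ≡ j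
    p-injective eq = trans (sym (inverseˡ p)) (trans (cong (p ⟨$⟩ˡ_) eq) (inverseˡ p))

  clear-all : Isolating (mp k p R) → ∀ ι → Acc _⊂_ (subset (Bad? ι)) →
    Occurrence ι → PointlessClear ι → Contains w (mp k p R)
  clear-all isolating ι (acc smaller) occ clear = by-cases (F.any? (Bad? ι))
    where
    by-cases : Dec (Σ (Fin n) (Bad ι)) → Contains w (mp k p R)
    by-cases (no noBad) = contains ι occ (λ x bad → noBad (x , bad))
    by-cases (yes (Q , bad)) =
      let (ι′ , occ′ , clear′ , fewerBad) = descend isolating ι occ clear Q bad
      in clear-all isolating ι′ (smaller fewerBad) occ′ clear′

-- Pointless shaded squares are enclosed diagonals of length one, so equal
-- enclosed diagonals force equal pointless shaded squares.
pointless-transfer : ∀ k (p : Permutation′ k) (R R′ : Mesh k) → SameEnc (mp k p R) (mp k p R′) →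
  ∀ a b → InR R a b → Pointless p a b → InR R′ a b
pointless-transfer k p R R′ sameEnc a b inR pointless
  with proj₁ (sameEnc (Singleton a b))
         (inj₂ (inj₂ (a , b , (λ _ _ → id , id) , (λ { _ _ (refl , refl) → inR }) , pointless)))
... | inj₁ (_ , _ , _ , _ , _ , D⊆R′ , _) = D⊆R′ a b (refl , refl)
... | inj₂ (inj₁ (_ , _ , _ , _ , _ , _ , D⊆R′ , _)) = D⊆R′ a b (refl , refl)
... | inj₂ (inj₂ (_ , _ , _ , D⊆R′ , _)) = D⊆R′ a b (refl , refl)

contains-transfer : ∀ k (p : Permutation′ k) (R R′ : Mesh k) → Isolating (mp k p R) →
  (∀ a b → InR R a b → Pointless p a b → InR R′ a b) →
  ∀ n (w : Permutation′ n) → Contains w (mp k p R′) → Contains w (mp k p R)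
contains-transfer k p R R′ isolating pointless⊆R′ n w (ι , increasing , iso , empty) =
  clear-all isolating ι (⊂-wellFounded _) (increasing , λ i j → proj₂ (iso i j))
    (λ a b inR pointless x ((lo , hi) , (vlo , vhi)) → empty a b (pointless⊆R′ a b inR pointless) x (lo , hi , vlo , vhi))
  where open Occurrences p R w

proposition5p5 : (k : ℕ) (p : Permutation′ k) (R R′ : Mesh k) →
    Isolating (mp k p R) → Isolating (mp k p R′) →
    SameEnc (mp k p R) (mp k p R′) →
    Coincident (mp k p R) (mp k p R′)
proposition5p5 k p R R′ isoR isoR′ sameEnc n w =
    (λ avoidsR → avoidsR ∘′ R′⇒R) , (λ avoidsR′ → avoidsR′ ∘′ R⇒R′)
  where
  sameEnc′ : SameEnc (mp k p R′) (mp k p R)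
  sameEnc′ D = proj₂ (sameEnc D) , proj₁ (sameEnc D)
  R′⇒R : Contains w (mp k p R′) → Contains w (mp k p R)
  R′⇒R = contains-transfer k p R R′ isoR (pointless-transfer k p R R′ sameEnc) n w
  R⇒R′ : Contains w (mp k p R) → Contains w (mp k p R′)
  R⇒R′ = contains-transfer k p R′ R isoR′ (pointless-transfer k p R′ R sameEnc′) n w
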